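{- Every LOU derivation $\rho$ (a derivation of the LSC in which every step reduces the leftmost-outermost useful redex) is a standard derivation.
   Context: LSC terms: $t::= x\mid \lambda x.t\mid tu\mid t[x\leftarrow u]$ (explicit substitution binding $x$), modulo $\alpha$. Shallow contexts $C::=\langle\cdot\rangle\mid \lambda x.C\mid Ct\mid tC\mid C[x\leftarrow t]$; general contexts also allow $t[x\leftarrow C]$; substitution contexts $L::=\langle\cdot\rangle\mid L[x\leftarrow t]$; applicative contexts $A::=C\langle L\,t\rangle$. Reduction: closure under shallow contexts of ${\tt dB}$: $(L\langle\lambda x.t\rangle)u\to L\langle t[x\leftarrow u]\rangle$ and ${\tt ls}$: $C\langle x\rangle[x\leftarrow u]\to C\langle u\rangle[x\leftarrow u]$ ($C$ not capturing $x$); an ${\tt ls}$-step $D\langle C\langle x\rangle[x\leftarrow u]\rangle\to D\langle C\langle u\rangle[x\leftarrow u]\rangle$ is written compactly $E\langle x\rangle\to E\langle u\rangle$ with $E=D\langle C[x\leftarrow u]\rangle$. Unfolding $t\!\downarrow$: $x\!\downarrow=x$, $(tu)\!\downarrow=t\!\downarrow u\!\downarrow$, $(\lambda x.t)\!\downarrow=\lambda x.t\!\downarrow$, $(t[x\leftarrow u])\!\downarrow=t\!\downarrow\{x\leftarrow u\!\downarrow\}$; relative unfolding $t\!\downarrow_{\langle\cdot\rangle}=t\!\downarrow$, $t\!\downarrow_{uC}=t\!\downarrow_{Cu}=t\!\downarrow_{\lambda x.C}=t\!\downarrow_C$, $t\!\downarrow_{C[x\leftarrow u]}=t\!\downarrow_C\{x\leftarrow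 u\!\downarrow\}$. A step is useful if it is a ${\tt dB}$-step, or an ${\tt ls}$-step $C\langle x\rangle\to C\langle r\rangle$ (compact form) with $r\!\downarrow_C$ containing a $\beta$-redex, or $r\!\downarrow_C$ an abstraction and $C$ applicative. Positions: a ${\tt dB}$-redex $C\langle L\langle\lambda x.t\rangle u\rangle$ has position $C$; a compact ${\tt ls}$-redex $C\langle x\rangle\to C\langle u\rangle$ has position $C$. $C\prec_p t$ means $t=C\langle u\rangle$ for some $u$. $\prec_O$: $\langle\cdot\rangle\prec_O C$ for $C\neq\langle\cdot\rangle$, closed under $E\langle\cdot\rangle$. $\prec_L$: if $C\prec_p t$, $D\prec_p u$ then $Cu\prec_L tD$ and $C[x\leftarrow u]\prec_L t[x\leftarrow D]$, closed under $E\langle\cdot\rangle$. $\prec_{LO}=\prec_O\cup\prec_L$, extended to redexes via positions. The LOU redex of a term is the $\prec_{LO}$-least useful redex. A derivation $R_1;\ldots;R_n$ is standard if there are no $i\in\{2,\ldots,n\}$ and $j<i$ such that $R_i$ is a residual (in the standard residual theory of the LSC) of a redex $Q$ of the source term of $R_j$ with $Q\prec_{LO}R_j$. -}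

module Defs where

open import Data.Nat using (ℕ; zero; suc; pred; _+_; _<_; _<ᵇ_; _≡ᵇ_)
open import Data.Bool using (if_then_else_)
open import Data.List using (List; []; _∷_; _++_; length; replicate)
open import Data.List.Relation.Unary.All using (All)
open import Data.Maybe using (Maybe; just; nothing; map)
open import Data.Product using (Σ; ∃; _×_; _,_)
open import Data.Sum using (_⊎_)
open import Data.Unit using (⊤)
open import Data.Empty using (⊥)
open import Relation.Nullary using (¬_)
open import Relation.Binary.PropositionalEquality using (_≡_; _≢_)

-- LSC terms, de Bruijn indices (terms modulo α).
--   es t u  represents  t[x←u], the ES binds index 0 in t.

data Term : Set where
  var : ℕ → Term
  lam : Term → Term
  app : Term → Term → Term
  es  : Term → Term → Term

↑ : ℕ → ℕ → Term → Term
↑ d c (var k) = if k <ᵇ c then var k else var (k + d)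
↑ d c (lam t) = lam (↑ d (suc c) t)
↑ d c (app t u) = app (↑ d c t) (↑ d c u)
↑ d c (es t u) = es (↑ d (suc c) t) (↑ d c u)

-- meta-level substitution  t{x←u}  where x is index d in t and u lives
-- in the scope outside the d binders above x
sub : ℕ → Term → Term → Term
sub d u (var k) = if k <ᵇ d then var k else (if k ≡ᵇ d then ↑ d 0 u else var (pred k))
sub d u (lam t) = lam (sub (suc d) u t)
sub d u (app t s) = app (sub d u t) (sub d u s)
sub d u (es t s) = es (sub (suc d) u t) (sub d u s)

unf : Term → Term
unf (var k) = var k
unf (lam t) = lam (unf t)
unf (app t u) = app (unf t) (unf u)
unf (es t u) = sub 0 (unf u) (unf t)

-- Positions: a context C with C ≺p t is identified with the path to its
-- hole in t.  dλ : under λ, dappL/dappR : left/right of application,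
-- desL : body of ES (shallow), desR : inside the substituted term (general).

data Dir : Set where
  dλ dappL dappR desL desR : Dir

Pos : Set
Pos = List Dir

Shallow : Pos → Set
Shallow p = All (λ d → d ≢ desR) p

Under : Dir → Pos → Set
Under d p = ∃ λ q → p ≡ d ∷ q

countλ : Pos → ℕ
countλ [] = 0
countλ (dλ ∷ p) = suc (countλ p)
countλ (_ ∷ p) = countλ p

-- relUnfAt t p = (subterm of t at p)↓_C  where C is the (shallow) context
-- of t corresponding to p  (nothing if p is not a shallow position of t)
relUnfAt : Term → Pos → Maybe Term
relUnfAt t [] = just (unf t)
relUnfAt (lam t) (dλ ∷ p) = relUnfAt t p
relUnfAt (app t s) (dappL ∷ p) = relUnfAt t p
relUnfAt (app t s) (dappR ∷ p) = relUnfAt s p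
relUnfAt (es t s) (desL ∷ p) = map (sub (countλ p) (unf s)) (relUnfAt t p)
relUnfAt _ _ = nothing

-- substitution contexts L, listed innermost ES first:
-- plugL [t₁ , … , tₙ] s = s[x₁←t₁]…[xₙ←tₙ]
plugL : List Term → Term → Term
plugL [] s = s
plugL (t ∷ ts) s = plugL ts (es s t)

-- Repl u d t c t' : c is a shallow path of t to an occurrence of the
-- variable bound by the ES [x←u] (d = binders crossed so far), and t' is t
-- with that occurrence replaced by u (suitably shifted).
data Repl (u : Term) : ℕ → Term → Pos → Term → Set where
  here : ∀ {d} → Repl u d (var d) [] (↑ (suc d) 0 u)
  lamR : ∀ {d t c t'} → Repl u (suc d) t c t' → Repl u d (lam t) (dλ ∷ c) (lam t')
  appLR : ∀ {d t s c t'} → Repl u d t c t' → Repl u d (app t s) (dappL ∷ c) (app t' s)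
  appRR : ∀ {d t s c s'} → Repl u d s c s' → Repl u d (app t s) (dappR ∷ c) (app t s')
  esLR : ∀ {d t s c t'} → Repl u (suc d) t c t' → Repl u d (es t s) (desL ∷ c) (es t' s)

-- t ⟶⟨ p ⟩ s : a step whose redex has position p
--   (dB: position of the application; ls: compact position, i.e. the path
--    of the substituted variable occurrence).
data _⟶⟨_⟩_ : Term → Pos → Term → Set where
  dB : ∀ ls b u → app (plugL ls (lam b)) u ⟶⟨ [] ⟩ plugL ls (es b (↑ (length ls) 0 u))
  lsS : ∀ {t c t' u} → Repl u 0 t c t' → es t u ⟶⟨ desL ∷ c ⟩ es t' u
  lamS : ∀ {t p t'} → t ⟶⟨ p ⟩ t' → lam t ⟶⟨ dλ ∷ p ⟩ lam t'
  appLS : ∀ {t p t' s} → t ⟶⟨ p ⟩ t' → app t s ⟶⟨ dappL ∷ p ⟩ app t' s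
  appRS : ∀ {t p s s'} → s ⟶⟨ p ⟩ s' → app t s ⟶⟨ dappR ∷ p ⟩ app t s'
  esLS : ∀ {t p t' s} → t ⟶⟨ p ⟩ t' → es t s ⟶⟨ desL ∷ p ⟩ es t' s

IsRedex : Term → Pos → Set
IsRedex t p = ∃ λ s → t ⟶⟨ p ⟩ s

IsDB : ∀ {t p s} → t ⟶⟨ p ⟩ s → Set
IsDB (dB _ _ _) = ⊤
IsDB (lsS _) = ⊥
IsDB (lamS r) = IsDB r
IsDB (appLS r) = IsDB r
IsDB (appRS r) = IsDB r
IsDB (esLS r) = IsDB r

data HasBeta : Term → Set where
  β-here : ∀ {t s} → HasBeta (app (lam t) s)
  β-lam : ∀ {t} → HasBeta t → HasBeta (lam t)
  β-appL : ∀ {t s} → HasBeta t → HasBeta (app t s)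
  β-appR : ∀ {t s} → HasBeta s → HasBeta (app t s)
  β-esL : ∀ {t s} → HasBeta t → HasBeta (es t s)
  β-esR : ∀ {t s} → HasBeta s → HasBeta (es t s)

IsAbs : Term → Set
IsAbs t = ∃ λ b → t ≡ lam b

-- applicative contexts A ::= C⟨L t⟩
Applicative : Pos → Set
Applicative p = Σ Pos λ c → Σ ℕ λ n → Shallow c × (p ≡ c ++ (dappL ∷ replicate n desL))

-- an ls-step C⟨x⟩ → C⟨r⟩ (compact form, position p) is useful if r↓_C has a
-- β-redex, or r↓_C is an abstraction and C is applicative; r↓_C is computed
-- in the target s (whose subterm at p is r).
Useful : ∀ {t p s} → t ⟶⟨ p ⟩ s → Set
Useful {t} {p} {s} r =
  IsDB r ⊎ (Σ Term λ v → relUnfAt s p ≡ just v × (HasBeta v ⊎ (IsAbs v × Applicative p)))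

data _≺O_ : Pos → Pos → Set where
  ≺O-strict : ∀ e d q → e ≺O (e ++ d ∷ q)

data _≺L_ : Pos → Pos → Set where
  ≺L-app : ∀ e p q → (e ++ dappL ∷ p) ≺L (e ++ dappR ∷ q)
  ≺L-es  : ∀ e p q → (e ++ desL ∷ p) ≺L (e ++ desR ∷ q)

_≺LO_ : Pos → Pos → Set
p ≺LO q = p ≺O q ⊎ p ≺L q

IsLOU : ∀ {t p s} → t ⟶⟨ p ⟩ s → Set
IsLOU {t} {p} r =
  Useful r × (∀ {q s'} (r' : t ⟶⟨ q ⟩ s') → Useful r' → (q ≡ p) ⊎ (p ≺LO q))

data Res : ∀ {t p s} → t ⟶⟨ p ⟩ s → Pos → Pos → Set where
  -- (L⟨λx.b⟩) u → L⟨b[x←u]⟩ at the root; the redex itself has no residual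
  dB-L   : ∀ {ls b u i q} → i < length ls →
           Res (dB ls b u) (dappL ∷ replicate i desL ++ desR ∷ q) (replicate i desL ++ desR ∷ q)
  dB-body : ∀ {ls b u q} →
           Res (dB ls b u) (dappL ∷ replicate (length ls) desL ++ dλ ∷ q)
                           (replicate (length ls) desL ++ desL ∷ q)
  dB-arg : ∀ {ls b u q} →
           Res (dB ls b u) (dappR ∷ q) (replicate (length ls) desL ++ desR ∷ q)
  -- C⟨x⟩[x←u] → C⟨u⟩[x←u] at the root: the redex itself has no residual,
  -- redexes inside u are duplicated, the others are unchanged
  ls-other : ∀ {t c t' u P} {rp : Repl u 0 t c t'} →
           P ≢ desL ∷ c → ¬ Under desR P → Res (lsS rp) P P
  ls-sub : ∀ {t c t' u q} {rp : Repl u 0 t c t'} → Res (lsS rp) (desR ∷ q) (desR ∷ q)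
  ls-copy : ∀ {t c t' u q} {rp : Repl u 0 t c t'} → Res (lsS rp) (desR ∷ q) (desL ∷ c ++ q)
  lam-in : ∀ {t p t' P P'} {r : t ⟶⟨ p ⟩ t'} → Res r P P' → Res (lamS r) (dλ ∷ P) (dλ ∷ P')
  lam-out : ∀ {t p t' P} {r : t ⟶⟨ p ⟩ t'} → ¬ Under dλ P → Res (lamS r) P P
  appL-in : ∀ {t p t' s P P'} {r : t ⟶⟨ p ⟩ t'} → Res r P P' → Res (appLS {s = s} r) (dappL ∷ P) (dappL ∷ P')
  appL-out : ∀ {t p t' s P} {r : t ⟶⟨ p ⟩ t'} → ¬ Under dappL P → Res (appLS {s = s} r) P P
  appR-in : ∀ {t p s s' P P'} {r : s ⟶⟨ p ⟩ s'} → Res r P P' → Res (appRS {t = t} r) (dappR ∷ P) (dappR ∷ P')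
  appR-out : ∀ {t p s s' P} {r : s ⟶⟨ p ⟩ s'} → ¬ Under dappR P → Res (appRS {t = t} r) P P
  esL-in : ∀ {t p t' s P P'} {r : t ⟶⟨ p ⟩ t'} → Res r P P' → Res (esLS {s = s} r) (desL ∷ P) (desL ∷ P')
  esL-out : ∀ {t p t' s P} {r : t ⟶⟨ p ⟩ t'} → ¬ Under desL P → Res (esLS {s = s} r) P P

data Deriv (t : Term) : Set where
  []  : Deriv t
  _∷_ : ∀ {p s} → t ⟶⟨ p ⟩ s → Deriv s → Deriv t

LOUDeriv : ∀ {t} → Deriv t → Set
LOUDeriv [] = ⊤
LOUDeriv (r ∷ ρ) = IsLOU r × LOUDeriv ρ

Hits : ∀ {t} → Deriv t → Pos → Set
Hits [] Q = ⊥
Hits (_∷_ {p = p} r ρ) Q = (Q ≡ p) ⊎ (Σ Pos λ Q' → Res r Q Q' × Hits ρ Q')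

Standard : ∀ {t} → Deriv t → Set
Standard [] = ⊤
Standard {t} (_∷_ {p = p} r ρ) =
  (∀ Q → IsRedex t Q → Q ≺LO p → ∀ Q' → Res r Q Q' → ¬ Hits ρ Q') × Standard ρ

{-# OPTIONS --safe #-}
module Submission where

-- Let Q ≺LO p, where p is the LOU redex of the first step.  A dB-redex is
-- always useful, so Q is an ls-redex, i.e. a variable occurrence, and every
-- useful redex lies strictly to its right.  Nothing lies below a variable and
-- redexes are shallow, so every useful redex sits in the argument of an
-- application whose function part contains Q.  A step there leaves Q as its
-- own residual, still a variable, and creates no useful redex to its left,
-- since outside that argument the reduct coincides with the source.  These
-- facts thus persist along a useful derivation, which never reduces Q.

open import Defs
open import Data.List using ([]; _∷_; _++_)
open import Data.List.Properties using (++-identityʳ)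
open import Data.List.Relation.Binary.Lex.Strict
  using (Lex-<; base; halt; this; next; <-irreflexive; <-transitive)
open import Data.List.Relation.Binary.Pointwise using (≡⇒Pointwise-≡)
open import Data.Maybe using (map)
open import Data.Nat using (ℕ)
open import Data.Product using (Σ; ∃; _×_; _,_)
open import Data.Sum using (_⊎_; inj₁; inj₂; map₂)
open import Data.Unit using (⊤; tt)
open import Function using (id)
open import Relation.Nullary using (¬_)
open import Relation.Binary.Definitions using (Transitive)
open import Relation.Binary.PropositionalEquality
  using (_≡_; refl; sym; trans; cong; subst; resp₂; isEquivalence)

private
  variable
    d : ℕ
    t s s' s'' u w : Term
    p q Q Q' a b c e : Pos

data _◁_ : Dir → Dir → Set where
  appL◁appR : dappL ◁ dappR
  esL◁esR   : desL ◁ desR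

infix 4 _⊏_

-- ≺LO is the lexicographic order on paths in which a prefix precedes its
-- extensions and the left branch of a node precedes its right branch.
_⊏_ : Pos → Pos → Set
_⊏_ = Lex-< _≡_ _◁_

◁-trans : Transitive _◁_
◁-trans appL◁appR ()
◁-trans esL◁esR ()

⊏-irrefl : ¬ p ⊏ p
⊏-irrefl = <-irreflexive (λ { refl () }) (≡⇒Pointwise-≡ refl)

⊏-trans : Transitive _⊏_
⊏-trans = <-transitive isEquivalence (resp₂ _◁_) ◁-trans

⊏-++ : ∀ e → p ⊏ q → e ++ p ⊏ e ++ q
⊏-++ []      p⊏q = p⊏q
⊏-++ (d ∷ e) p⊏q = next refl (⊏-++ e p⊏q)

≺LO⇒⊏ : p ≺LO q → p ⊏ q
≺LO⇒⊏ (inj₁ (≺O-strict e d q)) = subst (_⊏ e ++ d ∷ q) (++-identityʳ e) (⊏-++ e halt)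
≺LO⇒⊏ (inj₂ (≺L-app e _ _))    = ⊏-++ e (this appL◁appR)
≺LO⇒⊏ (inj₂ (≺L-es e _ _))     = ⊏-++ e (this esL◁esR)

data SubtermAt (P : Term → Set) : Term → Pos → Set where
  here  : P t → SubtermAt P t []
  lamₛ  : SubtermAt P t p → SubtermAt P (lam t) (dλ ∷ p)
  appLₛ : SubtermAt P t p → SubtermAt P (app t u) (dappL ∷ p)
  appRₛ : SubtermAt P u p → SubtermAt P (app t u) (dappR ∷ p)
  esLₛ  : SubtermAt P t p → SubtermAt P (es t u) (desL ∷ p)

SubtermAt-map : ∀ {P R : Term → Set} → (∀ {t} → P t → R t) →
                SubtermAt P t p → SubtermAt R t p
SubtermAt-map f (here x) = here (f x)
SubtermAt-map f (lamₛ s) = lamₛ (SubtermAt-map f s)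
SubtermAt-map f (appLₛ s) = appLₛ (SubtermAt-map f s)
SubtermAt-map f (appRₛ s) = appRₛ (SubtermAt-map f s)
SubtermAt-map f (esLₛ s) = esLₛ (SubtermAt-map f s)

ShallowPos : Term → Pos → Set
ShallowPos = SubtermAt (λ _ → ⊤)

IsVar : Term → Set
IsVar t = ∃ λ k → t ≡ var k

VarAt : Term → Pos → Set
VarAt = SubtermAt IsVar

Repl-varAt : Repl u d t c s → VarAt t c
Repl-varAt here = here (_ , refl)
Repl-varAt (lamR rp) = lamₛ (Repl-varAt rp)
Repl-varAt (appLR rp) = appLₛ (Repl-varAt rp)
Repl-varAt (appRR rp) = appRₛ (Repl-varAt rp)
Repl-varAt (esLR rp) = esLₛ (Repl-varAt rp)

step-shallowPos : t ⟶⟨ p ⟩ s → ShallowPos t p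
step-shallowPos (dB _ _ _) = here tt
step-shallowPos (lsS rp) = esLₛ (SubtermAt-map _ (Repl-varAt rp))
step-shallowPos (lamS r) = lamₛ (step-shallowPos r)
step-shallowPos (appLS r) = appLₛ (step-shallowPos r)
step-shallowPos (appRS r) = appRₛ (step-shallowPos r)
step-shallowPos (esLS r) = esLₛ (step-shallowPos r)

dB⊎varAt : (r : t ⟶⟨ p ⟩ s) → IsDB r ⊎ VarAt t p
dB⊎varAt (dB _ _ _) = inj₁ tt
dB⊎varAt (lsS rp) = inj₂ (esLₛ (Repl-varAt rp))
dB⊎varAt (lamS r) = map₂ lamₛ (dB⊎varAt r)
dB⊎varAt (appLS r) = map₂ appLₛ (dB⊎varAt r)
dB⊎varAt (appRS r) = map₂ appRₛ (dB⊎varAt r)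
dB⊎varAt (esLS r) = map₂ esLₛ (dB⊎varAt r)

InArgAt : Pos → Pos → Set
InArgAt e q = ∃ λ b → q ≡ e ++ dappR ∷ b

varAt-⊏-shallowPos : VarAt t Q → ShallowPos t p → Q ⊏ p →
                     Σ Pos λ e → Σ Pos λ a → Q ≡ e ++ dappL ∷ a × InArgAt e p
varAt-⊏-shallowPos (here _) (here _) (base ())
varAt-⊏-shallowPos (lamₛ v) (lamₛ s) (next refl Q⊏p) with varAt-⊏-shallowPos v s Q⊏p
... | e , a , refl , b , refl = dλ ∷ e , a , refl , b , refl
varAt-⊏-shallowPos (appLₛ v) (appLₛ s) (next refl Q⊏p) with varAt-⊏-shallowPos v s Q⊏p
... | e , a , refl , b , refl = dappL ∷ e , a , refl , b , refl
varAt-⊏-shallowPos (appLₛ v) (appRₛ s) (this appL◁appR) = [] , _ , refl , _ , refl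
varAt-⊏-shallowPos (appRₛ v) (appRₛ s) (next refl Q⊏p) with varAt-⊏-shallowPos v s Q⊏p
... | e , a , refl , b , refl = dappR ∷ e , a , refl , b , refl
varAt-⊏-shallowPos (esLₛ v) (esLₛ s) (next refl Q⊏p) with varAt-⊏-shallowPos v s Q⊏p
... | e , a , refl , b , refl = desL ∷ e , a , refl , b , refl

infix 4 _≈[_]_

data _≈[_]_ : Term → Pos → Term → Set where
  arg   : app u t ≈[ [] ] app u s
  lamᶜ  : t ≈[ e ] s → lam t ≈[ dλ ∷ e ] lam s
  appLᶜ : t ≈[ e ] s → app t u ≈[ dappL ∷ e ] app s u
  appRᶜ : t ≈[ e ] s → app u t ≈[ dappR ∷ e ] app u s
  esLᶜ  : t ≈[ e ] s → es t u ≈[ desL ∷ e ] es s u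

Repl-≈ : ∀ e → Repl u d t (e ++ dappR ∷ b) s → t ≈[ e ] s
Repl-≈ [] (appRR rp) = arg
Repl-≈ (dλ ∷ e) (lamR rp) = lamᶜ (Repl-≈ e rp)
Repl-≈ (dappL ∷ e) (appLR rp) = appLᶜ (Repl-≈ e rp)
Repl-≈ (dappR ∷ e) (appRR rp) = appRᶜ (Repl-≈ e rp)
Repl-≈ (desL ∷ e) (esLR rp) = esLᶜ (Repl-≈ e rp)
Repl-≈ (desR ∷ e) ()

step-≈ : ∀ e → t ⟶⟨ e ++ dappR ∷ b ⟩ s → t ≈[ e ] s
step-≈ [] (appRS r) = arg
step-≈ (dλ ∷ e) (lamS r) = lamᶜ (step-≈ e r)
step-≈ (dappL ∷ e) (appLS r) = appLᶜ (step-≈ e r)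
step-≈ (dappR ∷ e) (appRS r) = appRᶜ (step-≈ e r)
step-≈ (desL ∷ e) (lsS rp) = esLᶜ (Repl-≈ e rp)
step-≈ (desL ∷ e) (esLS r) = esLᶜ (step-≈ e r)
step-≈ (desR ∷ e) ()

≈-SubtermAt : ∀ {P} → t ≈[ e ] s →
              SubtermAt P t (e ++ dappL ∷ a) → SubtermAt P s (e ++ dappL ∷ a)
≈-SubtermAt arg (appLₛ v) = appLₛ v
≈-SubtermAt (lamᶜ t≈s) (lamₛ v) = lamₛ (≈-SubtermAt t≈s v)
≈-SubtermAt (appLᶜ t≈s) (appLₛ v) = appLₛ (≈-SubtermAt t≈s v)
≈-SubtermAt (appRᶜ t≈s) (appRₛ v) = appRₛ (≈-SubtermAt t≈s v)
≈-SubtermAt (esLᶜ t≈s) (esLₛ v) = esLₛ (≈-SubtermAt t≈s v)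

≈-plugL : ∀ ls → t ≈[ e ] plugL ls w →
          Σ Term λ w' → t ≡ plugL ls w' × Σ Pos λ e' → w' ≈[ e' ] w
≈-plugL [] t≈s = _ , refl , _ , t≈s
≈-plugL (_ ∷ ls) t≈s with ≈-plugL ls t≈s
... | _ , refl , _ , esLᶜ w'≈w = _ , refl , _ , w'≈w

≈-plugL-lam : ∀ ls {b} → t ≈[ e ] plugL ls (lam b) → ∃ λ b' → t ≡ plugL ls (lam b')
≈-plugL-lam ls t≈s with ≈-plugL ls t≈s
... | _ , refl , _ , lamᶜ _ = _ , refl

-- The disjunct IsDB r' suffices because dB-steps are always useful.
Mirrors : s ⟶⟨ q ⟩ s'' → t ⟶⟨ q ⟩ s' → Set
Mirrors {q = q} {s'' = s''} {s' = s'} r'' r' =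
  (IsDB r'' → IsDB r') × (relUnfAt s'' q ≡ relUnfAt s' q ⊎ IsDB r')

Mirrors-Useful : {r'' : s ⟶⟨ q ⟩ s''} {r' : t ⟶⟨ q ⟩ s'} →
                 Mirrors r'' r' → Useful r'' → Useful r'
Mirrors-Useful (dB⇒dB , _) (inj₁ db) = inj₁ (dB⇒dB db)
Mirrors-Useful (_ , inj₁ same) (inj₂ (v , unf≡v , shape)) =
  inj₂ (v , trans (sym same) unf≡v , shape)
Mirrors-Useful (_ , inj₂ db) (inj₂ _) = inj₁ db

Mirrors-esLS : {r'' : s ⟶⟨ q ⟩ s''} {r' : t ⟶⟨ q ⟩ s'} →
               Mirrors r'' r' → Mirrors (esLS {s = w} r'') (esLS {s = w} r')
Mirrors-esLS {q = q} {w = w} (dB⇒dB , inj₁ same) =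
  dB⇒dB , inj₁ (cong (map (sub (countλ q) (unf w))) same)
Mirrors-esLS (dB⇒dB , inj₂ db) = dB⇒dB , inj₂ db

Mirrored : Term → s ⟶⟨ q ⟩ s'' → Set
Mirrored {q = q} t r'' = Σ Term λ s' → Σ (t ⟶⟨ q ⟩ s') (Mirrors r'')

≈-reflects-Repl : t ≈[ e ] s → Repl u d s c s' →
                  InArgAt e c ⊎
                  Σ Term λ t' → Repl u d t c t' × relUnfAt s' c ≡ relUnfAt t' c
≈-reflects-Repl arg (appLR rp) = inj₂ (_ , appLR rp , refl)
≈-reflects-Repl arg (appRR rp) = inj₁ (_ , refl)
≈-reflects-Repl (lamᶜ t≈s) (lamR rp) with ≈-reflects-Repl t≈s rp
... | inj₁ (b , refl) = inj₁ (b , refl)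
... | inj₂ (_ , rp' , same) = inj₂ (_ , lamR rp' , same)
≈-reflects-Repl (appLᶜ t≈s) (appLR rp) with ≈-reflects-Repl t≈s rp
... | inj₁ (b , refl) = inj₁ (b , refl)
... | inj₂ (_ , rp' , same) = inj₂ (_ , appLR rp' , same)
≈-reflects-Repl (appLᶜ t≈s) (appRR rp) = inj₂ (_ , appRR rp , refl)
≈-reflects-Repl (appRᶜ t≈s) (appLR rp) = inj₂ (_ , appLR rp , refl)
≈-reflects-Repl (appRᶜ t≈s) (appRR rp) with ≈-reflects-Repl t≈s rp
... | inj₁ (b , refl) = inj₁ (b , refl)
... | inj₂ (_ , rp' , same) = inj₂ (_ , appRR rp' , same)
≈-reflects-Repl (esLᶜ {u = w} t≈s) (esLR {c = c} rp) with ≈-reflects-Repl t≈s rp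
... | inj₁ (b , refl) = inj₁ (b , refl)
... | inj₂ (_ , rp' , same) =
  inj₂ (_ , esLR rp' , cong (map (sub (countλ c) (unf w))) same)

≈-reflects-step : t ≈[ e ] s → (r'' : s ⟶⟨ q ⟩ s'') → InArgAt e q ⊎ Mirrored t r''
≈-reflects-step arg (dB ls b _) = inj₂ (_ , dB ls b _ , _ , inj₂ tt)
≈-reflects-step arg (appLS r) = inj₂ (_ , appLS r , id , inj₁ refl)
≈-reflects-step arg (appRS r) = inj₁ (_ , refl)
≈-reflects-step (lamᶜ t≈s) (lamS r) with ≈-reflects-step t≈s r
... | inj₁ (b , refl) = inj₁ (b , refl)
... | inj₂ (_ , r' , m) = inj₂ (_ , lamS r' , m)
≈-reflects-step (appLᶜ t≈s) (dB ls b u) with ≈-plugL-lam ls t≈s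
... | b' , refl = inj₂ (_ , dB ls b' u , _ , inj₂ tt)
≈-reflects-step (appLᶜ t≈s) (appLS r) with ≈-reflects-step t≈s r
... | inj₁ (b , refl) = inj₁ (b , refl)
... | inj₂ (_ , r' , m) = inj₂ (_ , appLS r' , m)
≈-reflects-step (appLᶜ t≈s) (appRS r) = inj₂ (_ , appRS r , id , inj₁ refl)
≈-reflects-step (appRᶜ {t = t₀} t≈s) (dB ls b _) = inj₂ (_ , dB ls b t₀ , _ , inj₂ tt)
≈-reflects-step (appRᶜ t≈s) (appLS r) = inj₂ (_ , appLS r , id , inj₁ refl)
≈-reflects-step (appRᶜ t≈s) (appRS r) with ≈-reflects-step t≈s r
... | inj₁ (b , refl) = inj₁ (b , refl)
... | inj₂ (_ , r' , m) = inj₂ (_ , appRS r' , m)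
≈-reflects-step (esLᶜ {u = w} t≈s) (lsS {c = c} rp) with ≈-reflects-Repl t≈s rp
... | inj₁ (b , refl) = inj₁ (b , refl)
... | inj₂ (_ , rp' , same) =
  inj₂ (_ , lsS rp' , (λ ()) , inj₁ (cong (map (sub (countλ c) (unf w))) same))
≈-reflects-step (esLᶜ {u = w} t≈s) (esLS r) with ≈-reflects-step t≈s r
... | inj₁ (b , refl) = inj₁ (b , refl)
... | inj₂ (_ , r' , m) = inj₂ (_ , esLS r' , Mirrors-esLS {w = w} {r'' = r} {r' = r'} m)

Res-left-of-step : ∀ e {r : t ⟶⟨ e ++ dappR ∷ b ⟩ s} →
                   Res r (e ++ dappL ∷ a) Q' → Q' ≡ e ++ dappL ∷ a
Res-left-of-step [] (appR-out _) = refl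
Res-left-of-step (_ ∷ e) (ls-other _ _) = refl
Res-left-of-step (_ ∷ e) (lam-in res) = cong (dλ ∷_) (Res-left-of-step e res)
Res-left-of-step (_ ∷ e) (lam-out _) = refl
Res-left-of-step (_ ∷ e) (appL-in res) = cong (dappL ∷_) (Res-left-of-step e res)
Res-left-of-step (_ ∷ e) (appL-out _) = refl
Res-left-of-step (_ ∷ e) (appR-in res) = cong (dappR ∷_) (Res-left-of-step e res)
Res-left-of-step (_ ∷ e) (appR-out _) = refl
Res-left-of-step (_ ∷ e) (esL-in res) = cong (desL ∷_) (Res-left-of-step e res)
Res-left-of-step (_ ∷ e) (esL-out _) = refl

PrecedesUseful : Term → Pos → Set
PrecedesUseful t Q = ∀ {q s} (r : t ⟶⟨ q ⟩ s) → Useful r → Q ⊏ q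

≈-PrecedesUseful : t ≈[ e ] s → PrecedesUseful t (e ++ dappL ∷ a) →
                   PrecedesUseful s (e ++ dappL ∷ a)
≈-PrecedesUseful {e = e} t≈s precedes r'' useful with ≈-reflects-step t≈s r''
... | inj₁ (b , refl) = ⊏-++ e (this appL◁appR)
... | inj₂ (_ , r' , m) = precedes r' (Mirrors-Useful {r'' = r''} {r' = r'} m useful)

IsLOU-PrecedesUseful : (r : t ⟶⟨ p ⟩ s) → IsLOU r → Q ⊏ p → PrecedesUseful t Q
IsLOU-PrecedesUseful _ (_ , least) Q⊏p r' useful with least r' useful
... | inj₁ refl = Q⊏p
... | inj₂ p≺q = ⊏-trans Q⊏p (≺LO⇒⊏ p≺q)

UsefulDeriv : Deriv t → Set
UsefulDeriv [] = ⊤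
UsefulDeriv (r ∷ ρ) = Useful r × UsefulDeriv ρ

LOUDeriv⇒UsefulDeriv : (ρ : Deriv t) → LOUDeriv ρ → UsefulDeriv ρ
LOUDeriv⇒UsefulDeriv [] _ = tt
LOUDeriv⇒UsefulDeriv (r ∷ ρ) ((useful , _) , lou) = useful , LOUDeriv⇒UsefulDeriv ρ lou

UsefulDeriv-¬Hits : PrecedesUseful t Q → VarAt t Q →
                    (ρ : Deriv t) → UsefulDeriv ρ → ¬ Hits ρ Q
UsefulDeriv-¬Hits _ _ [] _ ()
UsefulDeriv-¬Hits precedes _ (r ∷ ρ) (useful , _) (inj₁ refl) = ⊏-irrefl (precedes r useful)
UsefulDeriv-¬Hits precedes Q-var (r ∷ ρ) (useful , usefulρ) (inj₂ (_ , res , hit))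
  with varAt-⊏-shallowPos Q-var (step-shallowPos r) (precedes r useful)
... | e , _ , refl , _ , refl with Res-left-of-step e res
...   | refl = UsefulDeriv-¬Hits (≈-PrecedesUseful (step-≈ e r) precedes)
                                (≈-SubtermAt (step-≈ e r) Q-var) ρ usefulρ hit

PrecedesUseful-redex-¬Hits : PrecedesUseful t Q → IsRedex t Q →
                             (ρ : Deriv t) → UsefulDeriv ρ → ¬ Hits ρ Q
PrecedesUseful-redex-¬Hits precedes (_ , rQ) ρ usefulρ with dB⊎varAt rQ
... | inj₁ db = λ _ → ⊏-irrefl (precedes rQ (inj₁ db))
... | inj₂ Q-var = UsefulDeriv-¬Hits precedes Q-var ρ usefulρ

mainTheorem6 : ∀ {t} (ρ : Deriv t) → LOUDeriv ρ → Standard ρ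
mainTheorem6 [] _ = tt
mainTheorem6 {t} (_∷_ {p = p} r ρ) (lou , louρ) =
  earlier-redexes-untouched , mainTheorem6 ρ louρ
  where
  earlier-redexes-untouched :
    ∀ Q → IsRedex t Q → Q ≺LO p → ∀ Q' → Res r Q Q' → ¬ Hits ρ Q'
  earlier-redexes-untouched Q Q-redex Q≺p Q' res hit =
    PrecedesUseful-redex-¬Hits (IsLOU-PrecedesUseful r lou (≺LO⇒⊏ Q≺p)) Q-redex
      (r ∷ ρ) (LOUDeriv⇒UsefulDeriv (r ∷ ρ) (lou , louρ)) (inj₂ (Q' , res , hit))
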